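{- Let $m_1, m_2$ be integers with $m_1 \geq 0$ and $m_2 \geq \max\{2, m_1\}$, and let $G = K_{1,m_1}+K_{1,m_2}$, where $A$ (resp. $B$) denotes the partite set of size $m_1$ (resp. $m_2$) of the copy of $K_{1,m_1}$ (resp. $K_{1,m_2}$). Let $\sigma = \lfloor (m_1+m_2+2)/2 \rfloor$. Suppose $L$ is a list assignment for $G$ such that $|L(b)| \geq 3$ for all $b \in B$, $|L(a)| \geq 2$ for all $a \in V(G) - B$, and some color $c$ appears in at least $\sigma$ of the lists $L(v)$, $v \in A \cup B$. Then there is a proper $L$-coloring of $G$ that uses no color on more than $\sigma$ vertices.
   Context: $K_{1,0}$ is interpreted as $K_1$ (so if $m_1=0$, then $A=\emptyset$ and that component is a single vertex). A list assignment $L$ assigns to each vertex $v$ a set $L(v)$ of colors; a proper $L$-coloring is a proper coloring $f$ with $f(v)\in L(v)$ for all $v$. -}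

module Defs where

open import Data.Nat using (ℕ; _≤_; _≥_; _+_; ⌊_/2⌋; _≟_)
open import Data.Fin using (Fin)
open import Data.Empty using (⊥)
open import Data.Unit using (⊤)
open import Data.List using (List; []; _∷_; _++_; map; filter; length; allFin)
open import Data.List.Relation.Unary.Unique.Propositional using (Unique)
open import Data.List.Membership.Propositional using (_∈_)
open import Data.List.Membership.DecPropositional _≟_ using (_∈?_)
open import Data.Product using (_×_; Σ)
open import Relation.Binary.PropositionalEquality using (_≡_; _≢_)

-- Vertices of G = K_{1,m1} + K_{1,m2} (disjoint union):
-- centre u₁ with leaves a i (i : Fin m1) forming A,
-- centre u₂ with leaves b j (j : Fin m2) forming B.
data V (m1 m2 : ℕ) : Set where
  u₁ : V m1 m2
  a  : Fin m1 → V m1 m2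
  u₂ : V m1 m2
  b  : Fin m2 → V m1 m2

AB : (m1 m2 : ℕ) → List (V m1 m2)
AB m1 m2 = map a (allFin m1) ++ map b (allFin m2)

allV : (m1 m2 : ℕ) → List (V m1 m2)
allV m1 m2 = u₁ ∷ u₂ ∷ AB m1 m2

-- Colours are natural numbers; a list assignment gives each vertex a finite
-- set of colours, represented as a duplicate-free list (so |L v| = length).
ListAssignment : (m1 m2 : ℕ) → Set
ListAssignment m1 m2 = V m1 m2 → List ℕ

IsListAssignment : {m1 m2 : ℕ} → ListAssignment m1 m2 → Set
IsListAssignment {m1} {m2} L = (v : V m1 m2) → Unique (L v)

Proper : {m1 m2 : ℕ} → (V m1 m2 → ℕ) → Set
Proper {m1} {m2} f = ((i : Fin m1) → f u₁ ≢ f (a i)) × ((j : Fin m2) → f u₂ ≢ f (b j))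

ProperLColoring : {m1 m2 : ℕ} → ListAssignment m1 m2 → (V m1 m2 → ℕ) → Set
ProperLColoring {m1} {m2} L f = Proper f × ((v : V m1 m2) → f v ∈ L v)

colourClassSize : {m1 m2 : ℕ} → (V m1 m2 → ℕ) → ℕ → ℕ
colourClassSize {m1} {m2} f k = length (filter (λ v → f v ≟ k) (allV m1 m2))

occurrencesAB : {m1 m2 : ℕ} → ListAssignment m1 m2 → ℕ → ℕ
occurrencesAB {m1} {m2} L c = length (filter (λ v → c ∈? L v) (AB m1 m2))

σ : ℕ → ℕ → ℕ
σ m1 m2 = ⌊ m1 + m2 + 2 /2⌋

notB : {m1 m2 : ℕ} → V m1 m2 → Set
notB (b _) = ⊥
notB _     = ⊤

module Submission where

-- The colouring is greedy.  The centres u₁, u₂ get colours x₁, x₂ ≠ c from their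
-- lists.  A leaf of A gets c whenever c is in its list, otherwise a colour ≠ x₁; a leaf
-- of B gets c for the first (σ − #A-leaves coloured c) leaves whose list contains c,
-- otherwise a colour ≠ x₂, c (possible as |L(b)| ≥ 3).  So exactly σ leaves and no
-- centre receive c.  Any other colour k misses those σ leaves, hence occurs on at most
-- m1 + m2 − σ leaves and at most one centre, giving ≤ m1 + m2 + 1 − σ ≤ σ; if both
-- centres have colour k, no leaf has it and the class has 2 ≤ σ vertices.

open import Defs
open import Data.Nat using (ℕ; _≤_; _≥_)
open import Data.Fin using (Fin)
open import Data.List using (length)
open import Data.Product using (_×_; Σ; ∃)

open import Data.Nat using (zero; suc; _+_; _∸_; _⊓_; _<_; _≟_; ⌊_/2⌋; z≤n; s≤s; s≤s⁻¹)
open import Data.Nat.Properties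
open import Data.Fin using (zero; suc)
open import Data.Bool using (Bool; true; false; if_then_else_)
open import Data.List using (List; []; _∷_; _++_; map; filter; tabulate; allFin)
open import Data.List.Properties
  using (length-++; length-map; length-tabulate; filter-++; filter-none; filter-notAll; map-tabulate)
open import Data.List.Relation.Unary.All as All using (All)
open import Data.List.Relation.Unary.All.Properties using (++⁺; map⁺; tabulate⁺)
open import Data.List.Relation.Unary.AllPairs using (_∷_)
import Data.List.Relation.Unary.Any as Any
open import Data.List.Relation.Unary.Any using (here; there)
open import Data.List.Membership.Propositional using (_∈_; _∉_)
open import Data.List.Membership.Propositional.Properties using (∈-filter⁺)
open import Data.List.Membership.DecPropositional _≟_ using (_∈?_)
open import Data.List.Relation.Unary.Unique.Propositional using (Unique)
open import Data.Product using (_,_; proj₁; proj₂)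
open import Data.Unit using (tt)
open import Data.Empty using (⊥-elim)
open import Relation.Nullary using (Dec; yes; no; does; ¬_; ¬?)
open import Relation.Nullary.Decidable using (dec-true; dec-false)
open import Relation.Unary using (Pred; Decidable)
open import Relation.Binary.PropositionalEquality
open import Level using (Level)

private
  variable
    ℓ : Level
    A : Set

indicator : Bool → ℕ
indicator true  = 1
indicator false = 0

count : (m : ℕ) → (Fin m → Bool) → ℕ
count zero    t = 0
count (suc m) t = indicator (t zero) + count m (λ i → t (suc i))

count-cong : ∀ m {t u : Fin m → Bool} → (∀ i → t i ≡ u i) → count m t ≡ count m u
count-cong zero    t≗u = refl
count-cong (suc m) t≗u = cong₂ _+_ (cong indicator (t≗u zero)) (count-cong m (λ i → t≗u (suc i)))

count-≤ : ∀ m (t : Fin m → Bool) → count m t ≤ m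
count-≤ zero    t = z≤n
count-≤ (suc m) t with t zero
... | true  = s≤s (count-≤ m (λ i → t (suc i)))
... | false = m≤n⇒m≤1+n (count-≤ m (λ i → t (suc i)))

-- Greedy selection: keep the first r indices passing t, reject the others.
select : (m : ℕ) → (Fin m → Bool) → ℕ → Fin m → Bool
select m       t zero    i       = false
select (suc m) t (suc r) zero    = t zero
select (suc m) t (suc r) (suc i) = select m (λ i → t (suc i)) (if t zero then r else suc r) i

select-⊆ : ∀ m t r i → select m t r i ≡ true → t i ≡ true
select-⊆ (suc m) t (suc r) zero    sel = sel
select-⊆ (suc m) t (suc r) (suc i) sel =
  select-⊆ m (λ i → t (suc i)) (if t zero then r else suc r) i sel

count-select : ∀ m t r → count m (select m t r) ≡ r ⊓ count m t
count-select zero    t r       = sym (⊓-zeroʳ r)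
count-select (suc m) t zero    = count-none m
  where
  count-none : ∀ m → count m (λ _ → false) ≡ 0
  count-none zero    = refl
  count-none (suc m) = count-none m
count-select (suc m) t (suc r) with t zero
... | true  = cong suc (count-select m (λ i → t (suc i)) r)
... | false = count-select m (λ i → t (suc i)) (suc r)

module _ {P : Pred A ℓ} (P? : Decidable P) where

  length-filter-∷ : ∀ x xs → length (filter P? (x ∷ xs)) ≡ indicator (does (P? x)) + length (filter P? xs)
  length-filter-∷ x xs with does (P? x)
  ... | true  = refl
  ... | false = refl

  length-filter-allFin : ∀ m (h : Fin m → A) →
    length (filter P? (map h (allFin m))) ≡ count m (λ i → does (P? (h i)))
  length-filter-allFin m h = trans (cong (λ xs → length (filter P? xs)) (map-tabulate (λ i → i) h)) (go m h)
    where
    go : ∀ m (h : Fin m → A) → length (filter P? (tabulate h)) ≡ count m (λ i → does (P? (h i)))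
    go zero    h = refl
    go (suc m) h = trans (length-filter-∷ (h zero) _) (cong (_ +_) (go m (λ i → h (suc i))))

  length-filter-< : ∀ {x} xs → x ∈ xs → (∀ {y} → P y → y ≢ x) → length (filter P? xs) < length xs
  length-filter-< xs x∈xs P⇒≢ = filter-notAll P? xs (Any.map (λ x≡y Py → P⇒≢ Py (sym x≡y)) x∈xs)

length-filter-disjoint : {P Q : Pred A ℓ} (P? : Decidable P) (Q? : Decidable Q) →
  (∀ {x} → P x → ¬ Q x) → ∀ xs → length (filter P? xs) + length (filter Q? xs) ≤ length xs
length-filter-disjoint P? Q? disj [] = z≤n
length-filter-disjoint P? Q? disj (x ∷ xs) with P? x | Q? x | length-filter-disjoint P? Q? disj xs
... | yes p | yes q | _  = ⊥-elim (disj p q)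
... | yes _ | no _  | ih = s≤s ih
... | no _  | yes _ | ih = ≤-trans (≤-reflexive (+-suc _ _)) (s≤s ih)
... | no _  | no _  | ih = m≤n⇒m≤1+n ih

module _ {m1 m2 : ℕ} where

  length-AB : length (AB m1 m2) ≡ m1 + m2
  length-AB = trans (length-++ (map a (allFin m1)))
    (cong₂ _+_ (trans (length-map a (allFin m1)) (length-tabulate {n = m1} (λ i → i)))
               (trans (length-map b (allFin m2)) (length-tabulate {n = m2} (λ j → j))))

  All-AB : {P : Pred (V m1 m2) ℓ} → (∀ i → P (a i)) → (∀ j → P (b j)) → All P (AB m1 m2)
  All-AB Pa Pb = ++⁺ (map⁺ (tabulate⁺ Pa)) (map⁺ (tabulate⁺ Pb))

  length-filter-AB : {P : Pred (V m1 m2) ℓ} (P? : Decidable P) →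
    length (filter P? (AB m1 m2)) ≡ count m1 (λ i → does (P? (a i))) + count m2 (λ j → does (P? (b j)))
  length-filter-AB P? = begin
    length (filter P? (map a (allFin m1) ++ map b (allFin m2)))
      ≡⟨ cong length (filter-++ P? (map a (allFin m1)) _) ⟩
    length (filter P? (map a (allFin m1)) ++ filter P? (map b (allFin m2)))
      ≡⟨ length-++ (filter P? (map a (allFin m1))) ⟩
    length (filter P? (map a (allFin m1))) + length (filter P? (map b (allFin m2)))
      ≡⟨ cong₂ _+_ (length-filter-allFin P? m1 a) (length-filter-allFin P? m2 b) ⟩
    count m1 (λ i → does (P? (a i))) + count m2 (λ j → does (P? (b j))) ∎
    where open ≡-Reasoning

  leafClassSize : (V m1 m2 → ℕ) → ℕ → ℕ
  leafClassSize f k = length (filter (λ v → f v ≟ k) (AB m1 m2))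

  colourClassSize-split : ∀ (f : V m1 m2 → ℕ) k →
    colourClassSize f k ≡ indicator (does (f u₁ ≟ k)) + (indicator (does (f u₂ ≟ k)) + leafClassSize f k)
  colourClassSize-split f k = trans (length-filter-∷ (λ v → f v ≟ k) u₁ _)
    (cong (_ +_) (length-filter-∷ (λ v → f v ≟ k) u₂ (AB m1 m2)))

Avoiding : List ℕ → List ℕ → Set
Avoiding l fs = Σ ℕ λ y → y ∈ l × y ∉ fs

-- If the
-- head y is forbidden, recurse on the tail with y dropped from fs; the entry found
-- there differs from y by uniqueness, so it avoids all of fs.
avoid : (l : List ℕ) → Unique l → (fs : List ℕ) → length fs < length l → Avoiding l fs
avoid (y ∷ l) (y≢l ∷ unique) fs |fs|<|yl| with y ∈? fs
... | no y∉fs = y , here refl , y∉fs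
... | yes y∈fs with avoid l unique (filter (λ x → ¬? (x ≟ y)) fs) shorter
  where
  shorter : length (filter (λ x → ¬? (x ≟ y)) fs) < length l
  shorter = <-≤-trans (length-filter-< (λ x → ¬? (x ≟ y)) fs y∈fs (λ x≢y → x≢y)) (s≤s⁻¹ |fs|<|yl|)
...   | z , z∈l , z∉fs-y = z , there z∈l , z∉fs
  where
  z∉fs : z ∉ fs
  z∉fs z∈fs = z∉fs-y (∈-filter⁺ (λ x → ¬? (x ≟ y)) z∈fs (λ z≡y → All.lookup y≢l z∈l (sym z≡y)))

n≤1+2⌊n/2⌋ : ∀ n → n ≤ suc (⌊ n /2⌋ + ⌊ n /2⌋)
n≤1+2⌊n/2⌋ zero          = z≤n
n≤1+2⌊n/2⌋ (suc zero)    = s≤s z≤n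
n≤1+2⌊n/2⌋ (suc (suc n)) = s≤s (s≤s (≤-trans (n≤1+2⌊n/2⌋ n) (≤-reflexive (sym (+-suc _ _)))))

-- m1 + m2 < 2σ: a colour missing σ leaves is left with fewer than σ of them.
m1+m2<2σ : ∀ m1 m2 → m1 + m2 < σ m1 m2 + σ m1 m2
m1+m2<2σ m1 m2 = s≤s⁻¹ (subst (_≤ suc (σ m1 m2 + σ m1 m2)) (+-comm (m1 + m2) 2) (n≤1+2⌊n/2⌋ (m1 + m2 + 2)))

-- σ ≥ 2 once m2 ≥ 2: the class of the two centres is small enough.
2≤σ : ∀ m1 m2 → m2 ≥ 2 → 2 ≤ σ m1 m2
2≤σ m1 m2 m2≥2 = ⌊n/2⌋-mono {4} (+-monoˡ-≤ 2 (≤-trans m2≥2 (m≤n+m m2 m1)))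

-- σ ≥ m1 once m2 ≥ m1: all leaves of A may take the colour c.
m1≤σ : ∀ m1 m2 → m2 ≥ m1 → m1 ≤ σ m1 m2
m1≤σ m1 m2 m1≤m2 = ≤-trans (≤-reflexive (n≡⌊n+n/2⌋ m1))
  (⌊n/2⌋-mono (≤-trans (+-monoʳ-≤ m1 m1≤m2) (m≤m+n (m1 + m2) 2)))

top-up : ∀ {p q s} → p ≤ s → s ≤ p + q → p + (s ∸ p) ⊓ q ≡ s
top-up {p} {q} {s} p≤s s≤p+q =
  trans (cong (p +_) (m≤n⇒m⊓n≡m (m≤n+o⇒m∸n≤o s p s≤p+q))) (m+[n∸m]≡n p≤s)

classes-bounded : ∀ {m1 m2} (f : V m1 m2 → ℕ) → Proper f → ∀ c s →
  f u₁ ≢ c → f u₂ ≢ c → leafClassSize f c ≡ s → 2 ≤ s → m1 + m2 < s + s →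
  ∀ k → colourClassSize f k ≤ s
classes-bounded {m1} {m2} f (centre₁ , centre₂) c s u₁≢c u₂≢c leaves-c≡s 2≤s m1+m2<2s k =
  subst (_≤ s) (sym (colourClassSize-split f k)) (bound (k ≟ c) (f u₁ ≟ k) (f u₂ ≟ k))
  where
  -- Leaves of colour k ≠ c are disjoint from the s leaves of colour c.
  few-leaves : k ≢ c → leafClassSize f k < s
  few-leaves k≢c = +-cancelʳ-< s (leafClassSize f k) s (begin-strict
    leafClassSize f k + s               ≡⟨ cong (_ +_) (sym leaves-c≡s) ⟩
    leafClassSize f k + leafClassSize f c
      ≤⟨ length-filter-disjoint (λ v → f v ≟ k) (λ v → f v ≟ c) (λ fv≡k fv≡c → k≢c (trans (sym fv≡k) fv≡c)) (AB m1 m2) ⟩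
    length (AB m1 m2)                   ≡⟨ length-AB {m1} {m2} ⟩
    m1 + m2                             <⟨ m1+m2<2s ⟩
    s + s                               ∎)
    where open ≤-Reasoning

  -- A colour of both centres appears on no leaf, since leaves differ from their centre.
  no-leaves : f u₁ ≡ k → f u₂ ≡ k → leafClassSize f k ≡ 0
  no-leaves u₁≡k u₂≡k = cong length (filter-none (λ v → f v ≟ k)
    (All-AB (λ i ai≡k → centre₁ i (trans u₁≡k (sym ai≡k)))
            (λ j bj≡k → centre₂ j (trans u₂≡k (sym bj≡k)))))

  bound : Dec (k ≡ c) → (d₁ : Dec (f u₁ ≡ k)) (d₂ : Dec (f u₂ ≡ k)) →
    indicator (does d₁) + (indicator (does d₂) + leafClassSize f k) ≤ s
  bound (yes refl) (yes u₁≡c) _          = ⊥-elim (u₁≢c u₁≡c)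
  bound (yes refl) (no _)     (yes u₂≡c) = ⊥-elim (u₂≢c u₂≡c)
  bound (yes refl) (no _)     (no _)     = ≤-reflexive leaves-c≡s
  bound (no _)     (yes u₁≡k) (yes u₂≡k) rewrite no-leaves u₁≡k u₂≡k = 2≤s
  bound (no k≢c)   (yes _)    (no _)     = few-leaves k≢c
  bound (no k≢c)   (no _)     (yes _)    = few-leaves k≢c
  bound (no k≢c)   (no _)     (no _)     = <⇒≤ (few-leaves k≢c)

-- Parameters: a list assignment with the size conditions of the lemma, the colour c,
-- and the budget r of B-leaves that may receive c.
module GreedyColouring {m1 m2 : ℕ} (L : ListAssignment m1 m2) (unique : IsListAssignment L)
  (large-B : (j : Fin m2) → length (L (b j)) ≥ 3)
  (large : (v : V m1 m2) → notB v → length (L v) ≥ 2) (c r : ℕ) where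

  centre₁ : Avoiding (L u₁) (c ∷ [])
  centre₁ = avoid (L u₁) (unique u₁) (c ∷ []) (large u₁ tt)
  centre₂ : Avoiding (L u₂) (c ∷ [])
  centre₂ = avoid (L u₂) (unique u₂) (c ∷ []) (large u₂ tt)

  x₁ x₂ : ℕ
  x₁ = proj₁ centre₁
  x₂ = proj₁ centre₂

  fallback-A : (i : Fin m1) → Avoiding (L (a i)) (x₁ ∷ [])
  fallback-A i = avoid (L (a i)) (unique (a i)) (x₁ ∷ []) (large (a i) tt)

  fallback-B : (j : Fin m2) → Avoiding (L (b j)) (x₂ ∷ c ∷ [])
  fallback-B j = avoid (L (b j)) (unique (b j)) (x₂ ∷ c ∷ []) (large-B j)

  c-in-B : Fin m2 → Bool
  c-in-B j = does (c ∈? L (b j))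

  c-in-A : Fin m1 → Bool
  c-in-A i = does (c ∈? L (a i))

  chosen : Fin m2 → Bool
  chosen = select m2 c-in-B r

  colour-A : (i : Fin m1) → Dec (c ∈ L (a i)) → ℕ
  colour-A i (yes _) = c
  colour-A i (no _)  = proj₁ (fallback-A i)

  colour-B : Fin m2 → Bool → ℕ
  colour-B j true  = c
  colour-B j false = proj₁ (fallback-B j)

  f : V m1 m2 → ℕ
  f u₁    = x₁
  f u₂    = x₂
  f (a i) = colour-A i (c ∈? L (a i))
  f (b j) = colour-B j (chosen j)

  colour-A≡c : ∀ i (d : Dec (c ∈ L (a i))) → does (colour-A i d ≟ c) ≡ does d
  colour-A≡c i (yes _)   = dec-true (c ≟ c) refl
  colour-A≡c i (no c∉Lai) = dec-false (_ ≟ c) λ y≡c → c∉Lai (subst (_∈ L (a i)) y≡c (proj₁ (proj₂ (fallback-A i))))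

  colour-B≡c : ∀ j t → does (colour-B j t ≟ c) ≡ t
  colour-B≡c j true  = dec-true (c ≟ c) refl
  colour-B≡c j false = dec-false (_ ≟ c) λ y≡c → proj₂ (proj₂ (fallback-B j)) (there (here y≡c))

  centres-avoid-c : f u₁ ≢ c × f u₂ ≢ c
  centres-avoid-c = (λ e → proj₂ (proj₂ centre₁) (here e)) , (λ e → proj₂ (proj₂ centre₂) (here e))

  proper : ProperLColoring L f
  proper = (edge-A , edge-B) , in-list
    where
    edge-A : (i : Fin m1) → f u₁ ≢ f (a i)
    edge-A i with c ∈? L (a i)
    ... | yes _ = proj₁ centres-avoid-c
    ... | no _  = λ e → proj₂ (proj₂ (fallback-A i)) (here (sym e))

    edge-B : (j : Fin m2) → f u₂ ≢ f (b j)
    edge-B j with chosen j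
    ... | true  = proj₂ centres-avoid-c
    ... | false = λ e → proj₂ (proj₂ (fallback-B j)) (here (sym e))

    in-list-B : ∀ j t → chosen j ≡ t → colour-B j t ∈ L (b j)
    in-list-B j true  sel with c ∈? L (b j) | select-⊆ m2 c-in-B r j sel
    ... | yes c∈Lbj | _  = c∈Lbj
    ... | no _      | ()
    in-list-B j false _ = proj₁ (proj₂ (fallback-B j))

    in-list : (v : V m1 m2) → f v ∈ L v
    in-list u₁    = proj₁ (proj₂ centre₁)
    in-list u₂    = proj₁ (proj₂ centre₂)
    in-list (a i) with c ∈? L (a i)
    ... | yes c∈Lai = c∈Lai
    ... | no _      = proj₁ (proj₂ (fallback-A i))
    in-list (b j) = in-list-B j (chosen j) refl

  leaves-coloured-c : leafClassSize f c ≡ count m1 c-in-A + r ⊓ count m2 c-in-B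
  leaves-coloured-c = trans (length-filter-AB (λ v → f v ≟ c)) (cong₂ _+_
    (count-cong m1 (λ i → colour-A≡c i (c ∈? L (a i))))
    (trans (count-cong m2 (λ j → colour-B≡c j (chosen j))) (count-select m2 c-in-B r)))

lemma4p5 : (m1 m2 : ℕ) → m2 ≥ 2 → m2 ≥ m1 →
    (L : ListAssignment m1 m2) → IsListAssignment L →
    ((j : Fin m2) → length (L (b j)) ≥ 3) →
    ((v : V m1 m2) → notB v → length (L v) ≥ 2) →
    (∃ λ c → occurrencesAB L c ≥ σ m1 m2) →
    Σ (V m1 m2 → ℕ) λ f → ProperLColoring L f × ((k : ℕ) → colourClassSize f k ≤ σ m1 m2)
lemma4p5 m1 m2 m2≥2 m2≥m1 L unique large-B large (c , σ≤occ) =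
  f , proper , classes-bounded f (proj₁ proper) c (σ m1 m2)
                 (proj₁ centres-avoid-c) (proj₂ centres-avoid-c) leaves-c≡σ (2≤σ m1 m2 m2≥2) (m1+m2<2σ m1 m2)
  where
  -- Give c to every A-leaf containing it, then to σ − (that many) B-leaves.
  open GreedyColouring L unique large-B large c (σ m1 m2 ∸ count m1 (λ i → does (c ∈? L (a i))))

  leaves-c≡σ : leafClassSize f c ≡ σ m1 m2
  leaves-c≡σ = trans leaves-coloured-c (top-up
    (≤-trans (count-≤ m1 c-in-A) (m1≤σ m1 m2 m2≥m1))
    (≤-trans σ≤occ (≤-reflexive (length-filter-AB (λ v → c ∈? L v)))))
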